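{- Let $g:\mathbb{N}\to\mathbb{N}$ and $\beta:\mathbb{N}\to\mathbb{N}$ be weakly increasing, with $\beta$ unbounded, such that $g(n)\le \lfloor n^{1/\beta(n)}\rfloor$ for all $n$, and suppose $\beta^{ -1}$ is bounded by a primitive recursive function. Then $\nu_g$ is bounded by a primitive recursive function. If, furthermore, $g$ is primitive recursive, then $\nu_g$ is primitive recursive.
   Context: A natural number $N$ is identified with $\{0,1,\dots,N-1\}$, and $[X]^2$ denotes the set of two-element subsets of $X$. For $g:\mathbb{N}\to\mathbb{N}$, a coloring $c:[N]^2\to\mathbb{N}$ is $g$-regressive if $c(\{m,n\})\le g(\min\{m,n\})$ for all pairs. A set $B\subseteq N$ is min-homogeneous for $c$ if for all $\{m,n\}\in[B]^2$ the color $c(\{m,n\})$ depends only on $\min\{m,n\}$. $N\stackrel{\min}{\longrightarrow}(k)_g$ means every $g$-regressive coloring of $[N]^2$ has a min-homogeneous set of size $k$; $\nu_g(k)$ is the least such $N$. For unbounded $\beta$, $\beta^{ -1}(t)=\min\{n:\beta(n)\ge t\}$. -}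

module Defs where

open import Data.Nat using (ℕ; zero; suc; _+_; _*_; _^_; _≤_; _<_; _≤ᵇ_)
open import Data.Bool using (if_then_else_)
open import Data.Fin as Fin using (Fin)
open import Data.Vec using (Vec; []; _∷_; lookup; map)
open import Data.Product using (Σ; ∃; _×_; _,_)
open import Relation.Binary.PropositionalEquality using (_≡_)

data PR : ℕ → Set where
  pr-zero : PR 0
  pr-succ : PR 1
  pr-proj : {k : ℕ} → Fin k → PR k
  pr-comp : {k m : ℕ} → PR m → Vec (PR k) m → PR k
  pr-rec  : {k : ℕ} → PR k → PR (suc (suc k)) → PR (suc k)

mutual
  eval : {k : ℕ} → PR k → Vec ℕ k → ℕ
  eval pr-zero _ = 0
  eval pr-succ (x ∷ []) = suc x
  eval (pr-proj i) xs = lookup xs i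
  eval (pr-comp f gs) xs = eval f (evalAll gs xs)
  eval (pr-rec f h) (zero ∷ xs) = eval f xs
  eval (pr-rec f h) (suc n ∷ xs) = eval h (n ∷ eval (pr-rec f h) (n ∷ xs) ∷ xs)

  evalAll : {k m : ℕ} → Vec (PR k) m → Vec ℕ k → Vec ℕ m
  evalAll [] xs = []
  evalAll (g ∷ gs) xs = eval g xs ∷ evalAll gs xs

IsPrimRec : (ℕ → ℕ) → Set
IsPrimRec f = Σ (PR 1) λ p → ∀ n → eval p (n ∷ []) ≡ f n

PrimRecBounded : (ℕ → ℕ) → Set
PrimRecBounded f = Σ (ℕ → ℕ) λ h → IsPrimRec h × (∀ n → f n ≤ h n)

WeaklyIncreasing : (ℕ → ℕ) → Set
WeaklyIncreasing f = ∀ m n → m ≤ n → f m ≤ f n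

Unbounded : (ℕ → ℕ) → Set
Unbounded f = ∀ t → ∃ λ n → t ≤ f n

IsInverseAt : (ℕ → ℕ) → ℕ → ℕ → Set
IsInverseAt β t m = (t ≤ β m) × (∀ n → t ≤ β n → m ≤ n)

-- ⌊ n^(1/b) ⌋ : the largest k ≤ n with k^b ≤ n (meaningful for b ≥ 1)
rootSearch : ℕ → ℕ → ℕ → ℕ
rootSearch n b zero = 0
rootSearch n b (suc k) = if (suc k ^ b) ≤ᵇ n then suc k else rootSearch n b k

floorRoot : ℕ → ℕ → ℕ
floorRoot n b = rootSearch n b n

-- Regressive colorings and min-homogeneous sets
-- A coloring of [N]^2 is c : ℕ → ℕ → ℕ, with c m n the color of {m,n}
-- for m < n < N (other values are irrelevant).

Regressive : (ℕ → ℕ) → ℕ → (ℕ → ℕ → ℕ) → Set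
Regressive g N c = ∀ m n → m < n → n < N → c m n ≤ g m

MinHomogeneous : ℕ → (ℕ → ℕ → ℕ) → (k : ℕ) → (Fin k → ℕ) → Set
MinHomogeneous N c k b =
  (∀ i j → i Fin.< j → b i < b j) ×
  (∀ i → b i < N) ×
  (∀ i j l → i Fin.< j → i Fin.< l → c (b i) (b j) ≡ c (b i) (b l))

MinArrow : ℕ → ℕ → (ℕ → ℕ) → Set
MinArrow N k g = ∀ c → Regressive g N c → Σ (Fin k → ℕ) λ b → MinHomogeneous N c k b

IsNu : (ℕ → ℕ) → ℕ → ℕ → Set
IsNu g k N = MinArrow N k g × (∀ M → MinArrow M k g → N ≤ M)

-- Put A = 3^k + h(2k) + 1 and N = A². Since h(2k) ≥ β⁻¹(2k) we have β N ≥ 2k, so a g-regressive colouring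
-- of [N]² uses colours ≤ g N ≤ r = ⌊N^(1/β N)⌋, and s = max(r, 1) satisfies s^k ≤ A. Taking the least point and
-- passing to the largest colour class of its pairs, k times, finds a min-homogeneous k-set among any
-- (r + 2)^k ≤ 3^k s^k ≤ 3^k A ≤ N points; hence ν_g(k) ≤ N. N → (k)_g quantifies only over numbers below explicit bounds: a colouring of [N]² is a
-- number below (g N + 1)^(N²) read in base g N + 1, a k-set a number below (N + 1)^k read in base N + 1. So its
-- characteristic function is primitive recursive in g, and ν_g(k) is a bounded least search up to the bound.
module Submission where

open import Defs
open import Data.Nat
open import Data.Nat.Properties
open import Data.Fin as Fin using (Fin; #_; toℕ; fromℕ<)
open import Data.Fin.Properties using (toℕ-fromℕ<; toℕ<n)
open import Data.Vec using (Vec; []; _∷_; lookup; tabulate)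
open import Data.Vec.Properties using (tabulate∘lookup)
open import Data.List using (List; []; _∷_; length; filter; upTo)
open import Data.List.Properties using (filter-all; length-upTo)
open import Data.List.Membership.Propositional using (_∈_)
open import Data.List.Membership.Propositional.Properties using (∈-filter⁻; ∈-upTo⁻)
import Data.List.Relation.Binary.Sublist.Propositional.Properties as Sublist
open import Data.List.Relation.Unary.Any using (here; there)
import Data.List.Relation.Unary.All as All
open import Data.List.Relation.Unary.AllPairs using (AllPairs; _∷_)
import Data.List.Relation.Unary.AllPairs.Properties as AllPairs
open import Data.Product using (Σ; ∃; _×_; _,_; proj₁; proj₂)
open import Data.Sum using (_⊎_; inj₁; inj₂; [_,_]′)
open import Data.Bool using (true; false; T)
open import Data.Empty using (⊥-elim)
open import Function using (_∘_; id; flip)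
open import Relation.Nullary using (yes; no; ¬_)
import Relation.Unary as U
open import Relation.Unary.Properties using (∁?)
open import Relation.Binary.Definitions using (tri<; tri≈; tri>)
open import Relation.Binary.PropositionalEquality

sg : ℕ → ℕ
sg zero = 0
sg (suc _) = 1

-- Remainder and quotient modulo b + 1, by the recursion a primitive recursive program follows.
modSuc divSuc : ℕ → ℕ → ℕ
modSuc b zero = 0
modSuc b (suc x) = suc (modSuc b x) * sg (b ∸ modSuc b x)

divSuc b zero = 0
divSuc b (suc x) = divSuc b x + (1 ∸ sg (b ∸ modSuc b x))

modSuc≤ : ∀ b x → modSuc b x ≤ b
modSuc≤ b zero = z≤n
modSuc≤ b (suc x) with b ∸ modSuc b x in eq
... | zero = subst (_≤ b) (sym (*-zeroʳ (suc (modSuc b x)))) z≤n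
... | suc _ = subst (_≤ b) (sym (*-identityʳ (suc (modSuc b x))))
                (m∸n≢0⇒n<m λ b∸r≡0 → 1+n≢0 (trans (sym eq) b∸r≡0))

divSuc-modSuc : ∀ b x → modSuc b x + divSuc b x * suc b ≡ x
divSuc-modSuc b zero = refl
divSuc-modSuc b (suc x) with b ∸ modSuc b x in eq | divSuc-modSuc b x
... | zero | ih = begin
    suc r * 0 + (q + 1) * suc b ≡⟨ cong₂ _+_ (*-zeroʳ (suc r)) (cong (_* suc b) (+-comm q 1)) ⟩
    suc b + q * suc b          ≡⟨ cong (λ z → suc z + q * suc b) (sym r≡b) ⟩
    suc (r + q * suc b)        ≡⟨ cong suc ih ⟩
    suc x                      ∎
  where
  open ≡-Reasoning
  r = modSuc b x
  q = divSuc b x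
  r≡b : r ≡ b
  r≡b = ≤-antisym (modSuc≤ b x) (m∸n≡0⇒m≤n eq)
... | suc _ | ih = begin
    suc r * 1 + (q + 0) * suc b ≡⟨ cong₂ (λ u v → u + v * suc b) (*-identityʳ (suc r)) (+-identityʳ q) ⟩
    suc (r + q * suc b)         ≡⟨ cong suc ih ⟩
    suc x                       ∎
  where
  open ≡-Reasoning
  r = modSuc b x
  q = divSuc b x

private
  digit-dominates : ∀ b {r r′ q q′} → r ≤ b → q < q′ → r + q * suc b < r′ + q′ * suc b
  digit-dominates b {r} {r′} {q} {q′} r≤b q<q′ = begin-strict
    r + q * suc b   ≤⟨ +-monoˡ-≤ (q * suc b) r≤b ⟩
    b + q * suc b   <⟨ ≤-refl ⟩
    suc q * suc b   ≤⟨ *-monoˡ-≤ (suc b) q<q′ ⟩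
    q′ * suc b      ≤⟨ m≤n+m (q′ * suc b) r′ ⟩
    r′ + q′ * suc b ∎
    where open ≤-Reasoning

divMod-unique : ∀ b {r r′ q q′} → r ≤ b → r′ ≤ b →
  r + q * suc b ≡ r′ + q′ * suc b → r ≡ r′ × q ≡ q′
divMod-unique b {r} {r′} {q} {q′} r≤b r′≤b eq with <-cmp q q′
... | tri< q<q′ _ _ = ⊥-elim (<-irrefl eq (digit-dominates b r≤b q<q′))
... | tri> _ _ q>q′ = ⊥-elim (<-irrefl (sym eq) (digit-dominates b r′≤b q>q′))
... | tri≈ _ refl _ = +-cancelʳ-≡ (q * suc b) r r′ eq , refl

divModSuc-+* : ∀ b r q → r ≤ b → modSuc b (r + q * suc b) ≡ r × divSuc b (r + q * suc b) ≡ q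
divModSuc-+* b r q r≤b =
  divMod-unique b {q = divSuc b x} {q′ = q} (modSuc≤ b x) r≤b (divSuc-modSuc b x)
  where x = r + q * suc b

shiftDigits : ℕ → ℕ → ℕ → ℕ
shiftDigits b zero x = x
shiftDigits b (suc p) x = divSuc b (shiftDigits b p x)

-- digit b x p is the p-th digit of x in base b + 1.
digit : ℕ → ℕ → ℕ → ℕ
digit b x p = modSuc b (shiftDigits b p x)

encode : ℕ → (ℕ → ℕ) → ℕ → ℕ
encode b d zero = 0
encode b d (suc P) = d 0 + encode b (d ∘ suc) P * suc b

shiftDigits-suc : ∀ b p x → shiftDigits b (suc p) x ≡ shiftDigits b p (divSuc b x)
shiftDigits-suc b zero x = refl
shiftDigits-suc b (suc p) x = cong (divSuc b) (shiftDigits-suc b p x)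

module _ (b : ℕ) where

  Digits : (ℕ → ℕ) → ℕ → Set
  Digits d P = ∀ p → p < P → d p ≤ b

  digit-encode : ∀ {d P} → Digits d P → ∀ p → p < P → digit b (encode b d P) p ≡ d p
  digit-encode {d} {suc P} ds zero _ = proj₁ (divModSuc-+* b (d 0) (encode b (d ∘ suc) P) (ds 0 z<s))
  digit-encode {d} {suc P} ds (suc p) (s≤s p<P) = begin
    modSuc b (shiftDigits b (suc p) x) ≡⟨ cong (modSuc b) (shiftDigits-suc b p x) ⟩
    digit b (divSuc b x) p             ≡⟨ cong (λ z → digit b z p) (proj₂ (divModSuc-+* b (d 0) x′ (ds 0 z<s))) ⟩
    digit b x′ p                       ≡⟨ digit-encode (λ q q<P → ds (suc q) (s≤s q<P)) p p<P ⟩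
    d (suc p)                          ∎
    where
    open ≡-Reasoning
    x′ = encode b (d ∘ suc) P
    x = d 0 + x′ * suc b

  encode-< : ∀ {d P} → Digits d P → encode b d P < suc b ^ P
  encode-< {d} {zero} ds = z<s
  encode-< {d} {suc P} ds = begin-strict
    d 0 + x′ * suc b  <⟨ +-monoˡ-< (x′ * suc b) (s≤s (ds 0 z<s)) ⟩
    suc x′ * suc b    ≡⟨ *-comm (suc x′) (suc b) ⟩
    suc b * suc x′    ≤⟨ *-monoʳ-≤ (suc b) (encode-< (λ q q<P → ds (suc q) (s≤s q<P))) ⟩
    suc b * suc b ^ P ∎
    where
    open ≤-Reasoning
    x′ = encode b (d ∘ suc) P

PrimRecⁿ : (n : ℕ) → (Vec ℕ n → ℕ) → Set
PrimRecⁿ n f = Σ (PR n) λ p → ∀ xs → eval p xs ≡ f xs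

IsPrimRec₂ : (ℕ → ℕ → ℕ) → Set
IsPrimRec₂ f = Σ (PR 2) λ p → ∀ a b → eval p (a ∷ b ∷ []) ≡ f a b

IsPrimRec₃ : (ℕ → ℕ → ℕ → ℕ) → Set
IsPrimRec₃ f = Σ (PR 3) λ p → ∀ a b c → eval p (a ∷ b ∷ c ∷ []) ≡ f a b c

projections : ∀ {n m} → (Fin n → Fin m) → Vec (PR m) n
projections f = tabulate (pr-proj ∘ f)

evalAll-projections : ∀ {n m} (f : Fin n → Fin m) xs → evalAll (projections f) xs ≡ tabulate (lookup xs ∘ f)
evalAll-projections {zero} f xs = refl
evalAll-projections {suc n} f xs = cong (lookup xs (f Fin.zero) ∷_) (evalAll-projections (f ∘ Fin.suc) xs)

evalAll-identity : ∀ {n} (xs : Vec ℕ n) → evalAll (projections id) xs ≡ xs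
evalAll-identity xs = trans (evalAll-projections id xs) (tabulate∘lookup xs)

constPR : ∀ {n} → ℕ → PR n
constPR zero = pr-comp pr-zero []
constPR (suc c) = pr-comp pr-succ (constPR c ∷ [])

eval-constPR : ∀ {n} c (xs : Vec ℕ n) → eval (constPR c) xs ≡ c
eval-constPR zero xs = refl
eval-constPR (suc c) xs = cong suc (eval-constPR c xs)

comp₂ : ∀ {n} → PR 2 → PR n → PR n → PR n
comp₂ f a b = pr-comp f (a ∷ b ∷ [])

eval-pr-rec : ∀ {k} {z : PR k} {s : PR (suc (suc k))} (R : ℕ → Vec ℕ k → ℕ) →
  (∀ xs → eval z xs ≡ R 0 xs) → (∀ n xs → eval s (n ∷ R n xs ∷ xs) ≡ R (suc n) xs) →
  ∀ n xs → eval (pr-rec z s) (n ∷ xs) ≡ R n xs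
eval-pr-rec R base step zero xs = base xs
eval-pr-rec {s = s} R base step (suc n) xs =
  trans (cong (λ r → eval s (n ∷ r ∷ xs)) (eval-pr-rec R base step n xs)) (step n xs)

flip-primRec : ∀ {f} → IsPrimRec₂ f → IsPrimRec₂ (flip f)
flip-primRec (p , p-ok) = comp₂ p (pr-proj (# 1)) (pr-proj (# 0)) , λ a b → p-ok b a

+-primRec : IsPrimRec₂ _+_
+-primRec = pr-rec (pr-proj (# 0)) (pr-comp pr-succ (pr-proj (# 1) ∷ [])) ,
  λ a b → eval-pr-rec (λ { n (y ∷ []) → n + y }) (λ { (y ∷ []) → refl }) (λ { n (y ∷ []) → refl }) a (b ∷ [])

*-primRec : IsPrimRec₂ _*_
*-primRec = pr-rec (constPR 0) (comp₂ (proj₁ +-primRec) (pr-proj (# 2)) (pr-proj (# 1))) ,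
  λ a b → eval-pr-rec (λ { n (y ∷ []) → n * y }) (λ { (y ∷ []) → refl })
            (λ { n (y ∷ []) → proj₂ +-primRec y (n * y) }) a (b ∷ [])

bigOp : (ℕ → ℕ → ℕ) → ℕ → (ℕ → ℕ) → ℕ → ℕ
bigOp _∙_ e f zero = e
bigOp _∙_ e f (suc y) = bigOp _∙_ e f y ∙ f y

sumBelow prodBelow : (ℕ → ℕ) → ℕ → ℕ
sumBelow = bigOp _+_ 0
prodBelow = bigOp _*_ 1

bigOp-primRec : ∀ {n op e} {f : Vec ℕ (suc n) → ℕ} {B : Vec ℕ n → ℕ} →
  IsPrimRec₂ op → PrimRecⁿ (suc n) f → PrimRecⁿ n B →
  PrimRecⁿ n (λ xs → bigOp op e (λ i → f (i ∷ xs)) (B xs))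
bigOp-primRec {n} {op} {e} {f} {B} (pop , pop-ok) (pf , pf-ok) (pB , pB-ok) =
  pr-comp loop (pB ∷ projections id) , λ xs →
    trans (cong (eval loop) (cong₂ _∷_ (pB-ok xs) (evalAll-identity xs)))
          (eval-pr-rec R (eval-constPR e) step (B xs) xs)
  where
  -- the body reads the loop index and the outer variables, skipping the accumulator
  body : PR (suc (suc n))
  body = pr-comp pf (projections (Fin.punchIn (# 1)))
  loop : PR (suc n)
  loop = pr-rec (constPR e) (comp₂ pop (pr-proj (# 1)) body)
  R : ℕ → Vec ℕ n → ℕ
  R y xs = bigOp op e (λ i → f (i ∷ xs)) y
  eval-body : ∀ y r xs → eval body (y ∷ r ∷ xs) ≡ f (y ∷ xs)
  eval-body y r xs = trans (cong (eval pf) (trans (evalAll-projections (Fin.punchIn (# 1)) (y ∷ r ∷ xs))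
                                                  (cong (y ∷_) (tabulate∘lookup xs))))
                           (pf-ok (y ∷ xs))
  step : ∀ y xs → eval (comp₂ pop (pr-proj (# 1)) body) (y ∷ R y xs ∷ xs) ≡ R (suc y) xs
  step y xs = trans (pop-ok (R y xs) _) (cong (op (R y xs)) (eval-body y (R y xs) xs))

-- Terms in n variables over an oracle for a function g; the body of ∑< and ∏< binds the summation index as variable 0.
data Exp (n : ℕ) : Set where
  var    : Fin n → Exp n
  lit    : ℕ → Exp n
  oracle : Exp n → Exp n
  ap₁    : {f : ℕ → ℕ} → IsPrimRec f → Exp n → Exp n
  ap₂    : {f : ℕ → ℕ → ℕ} → IsPrimRec₂ f → Exp n → Exp n → Exp n
  ap₃    : {f : ℕ → ℕ → ℕ → ℕ} → IsPrimRec₃ f → Exp n → Exp n → Exp n → Exp n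
  ∑< ∏<  : Exp n → Exp (suc n) → Exp n

⟦_⟧ : ∀ {n} → Exp n → (ℕ → ℕ) → Vec ℕ n → ℕ
⟦ var i ⟧ g xs = lookup xs i
⟦ lit c ⟧ g xs = c
⟦ oracle a ⟧ g xs = g (⟦ a ⟧ g xs)
⟦ ap₁ {f} _ a ⟧ g xs = f (⟦ a ⟧ g xs)
⟦ ap₂ {f} _ a b ⟧ g xs = f (⟦ a ⟧ g xs) (⟦ b ⟧ g xs)
⟦ ap₃ {f} _ a b c ⟧ g xs = f (⟦ a ⟧ g xs) (⟦ b ⟧ g xs) (⟦ c ⟧ g xs)
⟦ ∑< B body ⟧ g xs = sumBelow (λ i → ⟦ body ⟧ g (i ∷ xs)) (⟦ B ⟧ g xs)
⟦ ∏< B body ⟧ g xs = prodBelow (λ i → ⟦ body ⟧ g (i ∷ xs)) (⟦ B ⟧ g xs)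

compile : ∀ {n g} → IsPrimRec g → (e : Exp n) → PrimRecⁿ n (⟦ e ⟧ g)
compile G (var i) = pr-proj i , λ xs → refl
compile G (lit c) = constPR c , eval-constPR c
compile {g = g} (pg , pg-ok) (oracle a) with compile (pg , pg-ok) a
... | pa , pa-ok = pr-comp pg (pa ∷ []) , λ xs → trans (pg-ok _) (cong g (pa-ok xs))
compile G (ap₁ {f} (p , p-ok) a) with compile G a
... | pa , pa-ok = pr-comp p (pa ∷ []) , λ xs → trans (p-ok _) (cong f (pa-ok xs))
compile G (ap₂ {f} (p , p-ok) a b) with compile G a | compile G b
... | pa , pa-ok | pb , pb-ok = comp₂ p pa pb , λ xs → trans (p-ok _ _) (cong₂ f (pa-ok xs) (pb-ok xs))
compile G (ap₃ {f} (p , p-ok) a b c) with compile G a | compile G b | compile G c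
... | pa , pa-ok | pb , pb-ok | pc , pc-ok = pr-comp p (pa ∷ pb ∷ pc ∷ []) , λ xs →
  trans (p-ok _ _ _) (trans (cong₂ (λ u v → f u v _) (pa-ok xs) (pb-ok xs)) (cong (f _ _) (pc-ok xs)))
compile G (∑< B body) = bigOp-primRec +-primRec (compile G body) (compile G B)
compile G (∏< B body) = bigOp-primRec *-primRec (compile G body) (compile G B)

id-primRec : IsPrimRec id
id-primRec = pr-proj (# 0) , λ _ → refl

suc-primRec : IsPrimRec suc
suc-primRec = pr-succ , λ _ → refl

const-primRec : ∀ c → IsPrimRec (λ _ → c)
const-primRec c = constPR c , λ n → eval-constPR c (n ∷ [])

recursion₂ : (R : ℕ → ℕ → ℕ) → IsPrimRec (R 0) → (step : Exp 3) →
  (∀ n y → ⟦ step ⟧ id (n ∷ R n y ∷ y ∷ []) ≡ R (suc n) y) → IsPrimRec₂ R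
recursion₂ R (pz , pz-ok) step step-ok with compile id-primRec step
... | ps , ps-ok = pr-rec pz ps , λ a b →
  eval-pr-rec (λ { n (y ∷ []) → R n y }) (λ { (y ∷ []) → pz-ok y })
              (λ { n (y ∷ []) → trans (ps-ok _) (step-ok n y) }) a (b ∷ [])

pred-primRec : IsPrimRec pred
pred-primRec = pr-rec pr-zero (pr-proj (# 0)) , λ { zero → refl ; (suc n) → refl }

sg-primRec : IsPrimRec sg
sg-primRec = pr-rec pr-zero (constPR 1) , λ { zero → refl ; (suc n) → refl }

infixl 6 _⊕_ _⊖_
infixl 7 _⊗_

_⊕_ _⊗_ : ∀ {n} → Exp n → Exp n → Exp n
a ⊕ b = ap₂ +-primRec a b
a ⊗ b = ap₂ *-primRec a b

∸-primRec : IsPrimRec₂ _∸_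
∸-primRec = flip-primRec (recursion₂ (λ y x → x ∸ y) id-primRec (ap₁ pred-primRec (var (# 1)))
  λ n x → pred[m∸n]≡m∸[1+n] x n)

_⊖_ : ∀ {n} → Exp n → Exp n → Exp n
a ⊖ b = ap₂ ∸-primRec a b

^-primRec : IsPrimRec₂ _^_
^-primRec = flip-primRec (recursion₂ (λ y x → x ^ y) (const-primRec 1) (var (# 2) ⊗ var (# 1)) λ _ _ → refl)

modSuc-primRec : IsPrimRec₂ modSuc
modSuc-primRec = flip-primRec (recursion₂ (λ x b → modSuc b x) (const-primRec 0)
  (ap₁ suc-primRec (var (# 1)) ⊗ ap₁ sg-primRec (var (# 2) ⊖ var (# 1))) λ _ _ → refl)

divSuc-primRec : IsPrimRec₂ divSuc
divSuc-primRec = flip-primRec (recursion₂ (λ x b → divSuc b x) (const-primRec 0)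
  (var (# 1) ⊕ (lit 1 ⊖ ap₁ sg-primRec (var (# 2) ⊖ ap₂ modSuc-primRec (var (# 2)) (var (# 0))))) λ _ _ → refl)

shiftDigits-primRec : IsPrimRec₃ λ p b x → shiftDigits b p x
shiftDigits-primRec with compile id-primRec (ap₂ divSuc-primRec (var (# 2)) (var (# 1)))
... | ps , ps-ok = pr-rec (pr-proj (# 1)) ps , λ p b x →
  eval-pr-rec (λ { p (b ∷ x ∷ []) → shiftDigits b p x }) (λ { (b ∷ x ∷ []) → refl })
              (λ { n (b ∷ x ∷ []) → ps-ok _ }) p (b ∷ x ∷ [])

digit-primRec : IsPrimRec₃ digit
digit-primRec
  with compile id-primRec (ap₂ modSuc-primRec (var (# 0)) (ap₃ shiftDigits-primRec (var (# 2)) (var (# 0)) (var (# 1))))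
... | p , p-ok = p , λ b x q → p-ok (b ∷ x ∷ q ∷ [])

1∸[m∸n]>0⇒m≤n : ∀ m n → 0 < 1 ∸ (m ∸ n) → m ≤ n
1∸[m∸n]>0⇒m≤n m n pos with m ∸ n in eq
... | zero = m∸n≡0⇒m≤n eq
... | suc d = ⊥-elim (<-irrefl (sym (0∸n≡0 d)) pos)

m≤n⇒1∸[m∸n]>0 : ∀ {m n} → m ≤ n → 0 < 1 ∸ (m ∸ n)
m≤n⇒1∸[m∸n]>0 m≤n rewrite m≤n⇒m∸n≡0 m≤n = z<s

m*n>0⇒m>0∧n>0 : ∀ m n → 0 < m * n → 0 < m × 0 < n
m*n>0⇒m>0∧n>0 (suc m) (suc n) _ = z<s , z<s
m*n>0⇒m>0∧n>0 (suc m) zero pos = ⊥-elim (<-irrefl (sym (*-zeroʳ m)) pos)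

m>0⇒n>0⇒m*n>0 : ∀ {m n} → 0 < m → 0 < n → 0 < m * n
m>0⇒n>0⇒m*n>0 {suc m} {suc n} _ _ = z<s

[1∸m]+n>0⇒m>0⇒n>0 : ∀ a b → 0 < (1 ∸ a) + b → 0 < a → 0 < b
[1∸m]+n>0⇒m>0⇒n>0 (suc a) b pos _ rewrite 0∸n≡0 a = pos

[m>0⇒n>0]⇒[1∸m]+n>0 : ∀ a b → (0 < a → 0 < b) → 0 < (1 ∸ a) + b
[m>0⇒n>0]⇒[1∸m]+n>0 zero b _ = z<s
[m>0⇒n>0]⇒[1∸m]+n>0 (suc a) b f rewrite 0∸n≡0 a = f z<s

prodBelow-pos⁻ : ∀ f y → 0 < prodBelow f y → ∀ i → i < y → 0 < f i
prodBelow-pos⁻ f (suc y) pos i i<1+y with m*n>0⇒m>0∧n>0 (prodBelow f y) (f y) pos | m<1+n⇒m<n∨m≡n i<1+y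
... | pos-below , _ | inj₁ i<y = prodBelow-pos⁻ f y pos-below i i<y
... | _ , pos-last | inj₂ refl = pos-last

prodBelow-pos⁺ : ∀ f y → (∀ i → i < y → 0 < f i) → 0 < prodBelow f y
prodBelow-pos⁺ f zero _ = z<s
prodBelow-pos⁺ f (suc y) all-pos =
  m>0⇒n>0⇒m*n>0 (prodBelow-pos⁺ f y λ i i<y → all-pos i (m<n⇒m<1+n i<y)) (all-pos y ≤-refl)

sumBelow-pos⁻ : ∀ f y → 0 < sumBelow f y → ∃ λ i → i < y × 0 < f i
sumBelow-pos⁻ f (suc y) pos with f y in eq
... | suc _ = y , ≤-refl , subst (0 <_) (sym eq) z<s
... | zero with sumBelow-pos⁻ f y (subst (0 <_) (+-identityʳ (sumBelow f y)) pos)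
...   | i , i<y , pos-i = i , m<n⇒m<1+n i<y , pos-i

sumBelow-pos⁺ : ∀ f y i → i < y → 0 < f i → 0 < sumBelow f y
sumBelow-pos⁺ f (suc y) i i<1+y pos-i with m<1+n⇒m<n∨m≡n i<1+y
... | inj₁ i<y = <-≤-trans (sumBelow-pos⁺ f y i i<y pos-i) (m≤m+n (sumBelow f y) (f y))
... | inj₂ refl = <-≤-trans pos-i (m≤n+m (f i) (sumBelow f i))

-- ∀< and ∃< bind their variable as variable 0.
data Formula (n : ℕ) : Set where
  _≤ᶠ_ _≡ᶠ_ : Exp n → Exp n → Formula n
  _∧ᶠ_ _⇒ᶠ_ : Formula n → Formula n → Formula n
  ∀< ∃<     : Exp n → Formula (suc n) → Formula n

infixr 3 _∧ᶠ_
infixr 4 _⇒ᶠ_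
infix 5 _≤ᶠ_ _≡ᶠ_ _<ᶠ_

_<ᶠ_ : ∀ {n} → Exp n → Exp n → Formula n
a <ᶠ b = ap₁ suc-primRec a ≤ᶠ b

Holds : ∀ {n} → Formula n → (ℕ → ℕ) → Vec ℕ n → Set
Holds (a ≤ᶠ b) g xs = ⟦ a ⟧ g xs ≤ ⟦ b ⟧ g xs
Holds (a ≡ᶠ b) g xs = ⟦ a ⟧ g xs ≡ ⟦ b ⟧ g xs
Holds (φ ∧ᶠ ψ) g xs = Holds φ g xs × Holds ψ g xs
Holds (φ ⇒ᶠ ψ) g xs = Holds φ g xs → Holds ψ g xs
Holds (∀< B φ) g xs = ∀ i → i < ⟦ B ⟧ g xs → Holds φ g (i ∷ xs)
Holds (∃< B φ) g xs = ∃ λ i → i < ⟦ B ⟧ g xs × Holds φ g (i ∷ xs)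

characteristic : ∀ {n} → Formula n → Exp n
characteristic (a ≤ᶠ b) = lit 1 ⊖ (a ⊖ b)
characteristic (a ≡ᶠ b) = characteristic (a ≤ᶠ b) ⊗ characteristic (b ≤ᶠ a)
characteristic (φ ∧ᶠ ψ) = characteristic φ ⊗ characteristic ψ
characteristic (φ ⇒ᶠ ψ) = (lit 1 ⊖ characteristic φ) ⊕ characteristic ψ
characteristic (∀< B φ) = ∏< B (characteristic φ)
characteristic (∃< B φ) = ∑< B (characteristic φ)

mutual
  characteristic-sound : ∀ {n} (φ : Formula n) g xs → 0 < ⟦ characteristic φ ⟧ g xs → Holds φ g xs
  characteristic-sound (a ≤ᶠ b) g xs pos = 1∸[m∸n]>0⇒m≤n _ _ pos
  characteristic-sound (a ≡ᶠ b) g xs pos with m*n>0⇒m>0∧n>0 _ _ pos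
  ... | a≤b , b≤a = ≤-antisym (1∸[m∸n]>0⇒m≤n _ _ a≤b) (1∸[m∸n]>0⇒m≤n _ _ b≤a)
  characteristic-sound (φ ∧ᶠ ψ) g xs pos with m*n>0⇒m>0∧n>0 _ _ pos
  ... | pos-φ , pos-ψ = characteristic-sound φ g xs pos-φ , characteristic-sound ψ g xs pos-ψ
  characteristic-sound (φ ⇒ᶠ ψ) g xs pos hφ =
    characteristic-sound ψ g xs ([1∸m]+n>0⇒m>0⇒n>0 _ _ pos (characteristic-complete φ g xs hφ))
  characteristic-sound (∀< B φ) g xs pos i i<B = characteristic-sound φ g (i ∷ xs) (prodBelow-pos⁻ _ _ pos i i<B)
  characteristic-sound (∃< B φ) g xs pos with sumBelow-pos⁻ _ _ pos
  ... | i , i<B , pos-i = i , i<B , characteristic-sound φ g (i ∷ xs) pos-i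

  characteristic-complete : ∀ {n} (φ : Formula n) g xs → Holds φ g xs → 0 < ⟦ characteristic φ ⟧ g xs
  characteristic-complete (a ≤ᶠ b) g xs a≤b = m≤n⇒1∸[m∸n]>0 a≤b
  characteristic-complete (a ≡ᶠ b) g xs a≡b =
    m>0⇒n>0⇒m*n>0 (m≤n⇒1∸[m∸n]>0 (≤-reflexive a≡b)) (m≤n⇒1∸[m∸n]>0 (≤-reflexive (sym a≡b)))
  characteristic-complete (φ ∧ᶠ ψ) g xs (hφ , hψ) =
    m>0⇒n>0⇒m*n>0 (characteristic-complete φ g xs hφ) (characteristic-complete ψ g xs hψ)
  characteristic-complete (φ ⇒ᶠ ψ) g xs hφ⇒ψ =
    [m>0⇒n>0]⇒[1∸m]+n>0 _ _ λ pos → characteristic-complete ψ g xs (hφ⇒ψ (characteristic-sound φ g xs pos))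
  characteristic-complete (∀< B φ) g xs h =
    prodBelow-pos⁺ _ _ λ i i<B → characteristic-complete φ g (i ∷ xs) (h i i<B)
  characteristic-complete (∃< B φ) g xs (i , i<B , hi) =
    sumBelow-pos⁺ _ _ i i<B (characteristic-complete φ g (i ∷ xs) hi)

-- Coding the arrow relation

module _ (g : ℕ → ℕ) (N : ℕ) where

  -- A colouring of [N]² is coded by the base-(g N + 1) number whose digit m * N + n is the colour of {m, n};
  -- a k-set is coded by the base-(N + 1) number whose digits list its elements.
  colourOf : ℕ → ℕ → ℕ → ℕ
  colourOf x m n = digit (g N) x (m * N + n)

  RegressiveCode : ℕ → Set
  RegressiveCode x = ∀ m → m < N → ∀ n → n < N → m < n → colourOf x m n ≤ g m

  HomogeneousCode : ℕ → ℕ → ℕ → Set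
  HomogeneousCode k x y =
      (∀ i → i < k → digit N y i < N)
    × (∀ i → i < k → ∀ j → j < k → i < j → digit N y i < digit N y j)
    × (∀ i → i < k → ∀ j → j < k → ∀ l → l < k → i < j → i < l →
         colourOf x (digit N y i) (digit N y j) ≡ colourOf x (digit N y i) (digit N y l))

  MinArrowCode : ℕ → Set
  MinArrowCode k = ∀ x → x < suc (g N) ^ (N * N) → RegressiveCode x →
    ∃ λ y → y < suc N ^ k × HomogeneousCode k x y

minArrowᶠ : Formula 2
minArrowᶠ =
  ∀< (ap₂ ^-primRec (ap₁ suc-primRec (oracle (var (# 0)))) (var (# 0) ⊗ var (# 0)))
     (regressive ⇒ᶠ ∃< (ap₂ ^-primRec (ap₁ suc-primRec (var (# 1))) (var (# 2))) homogeneous)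
  where
  -- variables of the body, innermost first: n, m, x, N, k
  regressive : Formula 3
  regressive = ∀< (var (# 1)) (∀< (var (# 2)) (var (# 1) <ᶠ var (# 0) ⇒ᶠ
    ap₃ digit-primRec (oracle (var (# 3))) (var (# 2)) (var (# 1) ⊗ var (# 3) ⊕ var (# 0)) ≤ᶠ oracle (var (# 1))))
  -- variables, innermost first: i, y, x, N, k
  bounded : Formula 5
  bounded = ap₃ digit-primRec (var (# 3)) (var (# 1)) (var (# 0)) <ᶠ var (# 3)
  -- variables, innermost first: j, i, y, x, N, k
  increasing : Formula 6
  increasing = var (# 1) <ᶠ var (# 0) ⇒ᶠ
    ap₃ digit-primRec (var (# 4)) (var (# 2)) (var (# 1)) <ᶠ ap₃ digit-primRec (var (# 4)) (var (# 2)) (var (# 0))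
  -- variables, innermost first: l, j, i, y, x, N, k
  minHomogeneous : Formula 7
  minHomogeneous = var (# 2) <ᶠ var (# 1) ⇒ᶠ var (# 2) <ᶠ var (# 0) ⇒ᶠ
    colour (element (# 2)) (element (# 1)) ≡ᶠ colour (element (# 2)) (element (# 0))
    where
    element : Fin 7 → Exp 7
    element i = ap₃ digit-primRec (var (# 5)) (var (# 3)) (var i)
    colour : Exp 7 → Exp 7 → Exp 7
    colour a b = ap₃ digit-primRec (oracle (var (# 5))) (var (# 4)) (a ⊗ var (# 5) ⊕ b)
  homogeneous : Formula 4
  homogeneous = ∀< (var (# 3)) bounded
             ∧ᶠ ∀< (var (# 3)) (∀< (var (# 4)) increasing)
             ∧ᶠ ∀< (var (# 3)) (∀< (var (# 4)) (∀< (var (# 5)) minHomogeneous))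

minArrowᶠ-meaning : ∀ g N k → Holds minArrowᶠ g (N ∷ k ∷ []) ≡ MinArrowCode g N k
minArrowᶠ-meaning g N k = refl

extendFin : ∀ {k} → (Fin k → ℕ) → ℕ → ℕ
extendFin {zero} b i = 0
extendFin {suc k} b zero = b Fin.zero
extendFin {suc k} b (suc i) = extendFin (b ∘ Fin.suc) i

extendFin-fromℕ< : ∀ {k} (b : Fin k → ℕ) {i} (i<k : i < k) → extendFin b i ≡ b (fromℕ< i<k)
extendFin-fromℕ< {suc k} b {zero} i<k = refl
extendFin-fromℕ< {suc k} b {suc i} (s≤s i<k) = extendFin-fromℕ< (b ∘ Fin.suc) i<k

fromℕ<-mono-< : ∀ {i j k} (i<k : i < k) (j<k : j < k) → i < j → fromℕ< i<k Fin.< fromℕ< j<k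
fromℕ<-mono-< i<k j<k = subst₂ _<_ (sym (toℕ-fromℕ< i<k)) (sym (toℕ-fromℕ< j<k))

minArrow⇒code : ∀ {g N k} → MinArrow N k g → MinArrowCode g N k
minArrow⇒code {g} {N} {k} arrow x _ x-reg
  with arrow (colourOf g N x) (λ m n m<n n<N → x-reg m (<-trans m<n n<N) n n<N m<n)
... | b , b-inc , b<N , b-hom = y , encode-< N b-digits , bounded , increasing , minHomogeneous
  where
  b-digits : Digits N (extendFin b) k
  b-digits i i<k rewrite extendFin-fromℕ< b i<k = <⇒≤ (b<N _)
  y : ℕ
  y = encode N (extendFin b) k
  element : ∀ {i} (i<k : i < k) → digit N y i ≡ b (fromℕ< i<k)
  element i<k = trans (digit-encode N b-digits _ i<k) (extendFin-fromℕ< b i<k)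
  bounded : ∀ i → i < k → digit N y i < N
  bounded i i<k rewrite element i<k = b<N _
  increasing : ∀ i → i < k → ∀ j → j < k → i < j → digit N y i < digit N y j
  increasing i i<k j j<k i<j rewrite element i<k | element j<k = b-inc _ _ (fromℕ<-mono-< i<k j<k i<j)
  minHomogeneous : ∀ i → i < k → ∀ j → j < k → ∀ l → l < k → i < j → i < l →
    colourOf g N x (digit N y i) (digit N y j) ≡ colourOf g N x (digit N y i) (digit N y l)
  minHomogeneous i i<k j j<k l l<k i<j i<l rewrite element i<k | element j<k | element l<k =
    b-hom _ _ _ (fromℕ<-mono-< i<k j<k i<j) (fromℕ<-mono-< i<k l<k i<l)

onIncreasingPairs : (ℕ → ℕ → ℕ) → ℕ → ℕ → ℕ
onIncreasingPairs c m n with m <? n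
... | yes _ = c m n
... | no _ = 0

-- Divides by N, as divSuc and modSuc divide by their first argument plus one; for N = 0 there are no positions.
pairColour : (ℕ → ℕ → ℕ) → ℕ → ℕ → ℕ
pairColour c N p = onIncreasingPairs c (divSuc (N ∸ 1) p) (modSuc (N ∸ 1) p)

pairIndex-< : ∀ {N m n} → m < N → n < N → m * N + n < N * N
pairIndex-< {N} {m} {n} m<N n<N = begin-strict
  m * N + n <⟨ +-monoʳ-< (m * N) n<N ⟩
  m * N + N ≡⟨ +-comm (m * N) N ⟩
  suc m * N ≤⟨ *-monoˡ-≤ N m<N ⟩
  N * N     ∎
  where open ≤-Reasoning

pairColour-at : ∀ c {N m n} → m < N → n < N → m < n → pairColour c N (m * N + n) ≡ c m n
pairColour-at c {suc N′} {m} {n} m<N n<N m<n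
  rewrite +-comm (m * suc N′) n | divModSuc-+* N′ n m (≤-pred n<N) .proj₁ | divModSuc-+* N′ n m (≤-pred n<N) .proj₂
  with m <? n
... | yes _ = refl
... | no m≮n = ⊥-elim (m≮n m<n)

pairColour-digits : ∀ {g N c} → WeaklyIncreasing g → Regressive g N c → Digits (g N) (pairColour c N) (N * N)
pairColour-digits {g} {suc N′} {c} g↑ c-reg p p<N² with divSuc N′ p <? modSuc N′ p
... | yes m<n = ≤-trans (c-reg _ _ m<n n<N) (g↑ _ _ (<⇒≤ (<-trans m<n n<N)))
  where
  n<N : modSuc N′ p < suc N′
  n<N = s≤s (modSuc≤ N′ p)
... | no _ = z≤n

code⇒minArrow : ∀ {g N k} → WeaklyIncreasing g → MinArrowCode g N k → MinArrow N k g
code⇒minArrow {g} {N} {k} g↑ code c c-reg = decodeSet (code x (encode-< (g N) digits) x-reg)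
  where
  digits : Digits (g N) (pairColour c N) (N * N)
  digits = pairColour-digits g↑ c-reg
  x : ℕ
  x = encode (g N) (pairColour c N) (N * N)
  colourOf-x : ∀ {m n} → m < N → n < N → m < n → colourOf g N x m n ≡ c m n
  colourOf-x m<N n<N m<n = trans (digit-encode (g N) digits _ (pairIndex-< m<N n<N)) (pairColour-at c m<N n<N m<n)
  x-reg : RegressiveCode g N x
  x-reg m m<N n n<N m<n rewrite colourOf-x m<N n<N m<n = c-reg m n m<n n<N
  decodeSet : (∃ λ y → y < suc N ^ k × HomogeneousCode g N k x y) → Σ (Fin k → ℕ) (MinHomogeneous N c k)
  decodeSet (y , _ , bounded , increasing , minHomogeneous) = b , b-inc , b<N , b-hom
    where
    b : Fin k → ℕ
    b i = digit N y (toℕ i)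
    b-inc : ∀ i j → i Fin.< j → b i < b j
    b-inc i j = increasing _ (toℕ<n i) _ (toℕ<n j)
    b<N : ∀ i → b i < N
    b<N i = bounded _ (toℕ<n i)
    b-hom : ∀ i j l → i Fin.< j → i Fin.< l → c (b i) (b j) ≡ c (b i) (b l)
    b-hom i j l i<j i<l = begin
      c (b i) (b j)            ≡⟨ colourOf-x (b<N i) (b<N j) (b-inc i j i<j) ⟨
      colourOf g N x (b i) (b j) ≡⟨ minHomogeneous _ (toℕ<n i) _ (toℕ<n j) _ (toℕ<n l) i<j i<l ⟩
      colourOf g N x (b i) (b l) ≡⟨ colourOf-x (b<N i) (b<N l) (b-inc i l i<l) ⟩
      c (b i) (b l)            ∎
      where open ≡-Reasoning

minArrowχ : (ℕ → ℕ) → ℕ → ℕ → ℕ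
minArrowχ g N k = ⟦ characteristic minArrowᶠ ⟧ g (N ∷ k ∷ [])

minArrowχ-sound : ∀ {g N k} → WeaklyIncreasing g → 0 < minArrowχ g N k → MinArrow N k g
minArrowχ-sound {g} {N} {k} g↑ pos =
  code⇒minArrow g↑ (subst id (minArrowᶠ-meaning g N k) (characteristic-sound minArrowᶠ g (N ∷ k ∷ []) pos))

minArrowχ-complete : ∀ {g N k} → MinArrow N k g → 0 < minArrowχ g N k
minArrowχ-complete {g} {N} {k} arrow =
  characteristic-complete minArrowᶠ g (N ∷ k ∷ []) (subst id (sym (minArrowᶠ-meaning g N k)) (minArrow⇒code arrow))

minArrowχ-primRec : ∀ {g} → IsPrimRec g → IsPrimRec₂ (minArrowχ g)
minArrowχ-primRec {g} G = proj₁ χ , λ N k → proj₂ χ (N ∷ k ∷ [])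
  where
  χ : PrimRecⁿ 2 (⟦ characteristic minArrowᶠ ⟧ g)
  χ = compile G (characteristic minArrowᶠ)

-- Greedy construction of min-homogeneous sets

module _ {P : ℕ → Set} (P? : U.Decidable P) where

  length-filter+∁ : ∀ xs → length (filter P? xs) + length (filter (∁? P?) xs) ≡ length xs
  length-filter+∁ [] = refl
  length-filter+∁ (x ∷ xs) with P? x
  ... | yes _ = cong suc (length-filter+∁ xs)
  ... | no _ = trans (+-suc _ _) (cong suc (length-filter+∁ xs))

module _ (colour : ℕ → ℕ) where

  colourClass : ℕ → List ℕ → List ℕ
  colourClass col = filter (λ x → colour x ≟ col)

  pigeonhole : ∀ D L xs → (∀ {x} → x ∈ xs → colour x ≤ D) → suc D * L ≤ length xs →
    ∃ λ col → L ≤ length (colourClass col xs)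
  pigeonhole zero L xs colours≤0 len =
    0 , subst (L ≤_) (cong length (sym (filter-all (λ x → colour x ≟ 0) (All.tabulate (n≤0⇒n≡0 ∘ colours≤0)))))
                     (subst (_≤ length xs) (+-identityʳ L) len)
  pigeonhole (suc D) L xs colours≤ len with L ≤? length (colourClass (suc D) xs)
  ... | yes big = suc D , big
  ... | no small with pigeonhole D L rest colours≤D len-rest
    where
    top? : U.Decidable (λ x → colour x ≡ suc D)
    top? x = colour x ≟ suc D
    rest : List ℕ
    rest = filter (∁? top?) xs
    colours≤D : ∀ {x} → x ∈ rest → colour x ≤ D
    colours≤D x∈ with ∈-filter⁻ (∁? top?) x∈
    ... | x∈xs , not-top = ≤-pred (≤∧≢⇒< (colours≤ x∈xs) not-top)
    len-rest : suc D * L ≤ length rest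
    len-rest = +-cancelˡ-≤ L _ _ (begin
      L + suc D * L                               ≤⟨ len ⟩
      length xs                                   ≡⟨ length-filter+∁ top? xs ⟨
      length (colourClass (suc D) xs) + length rest ≤⟨ +-monoˡ-≤ (length rest) (<⇒≤ (≰⇒> small)) ⟩
      L + length rest                             ∎)
      where open ≤-Reasoning
  ... | col , big =
    col , ≤-trans big (Sublist.length-mono-≤ (Sublist.filter⁺ _ _ (λ { refl → id }) (Sublist.filter-⊆ _ xs)))

greedyLength : ℕ → ℕ → ℕ
greedyLength D zero = 0
greedyLength D (suc k) = suc (suc D * greedyLength D k)

-- Take the least element a, then recurse into the largest class of the colouring c a of the remaining elements.
greedy : ∀ (c : ℕ → ℕ → ℕ) D k {xs} → AllPairs _<_ xs → greedyLength D k ≤ length xs →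
  (∀ {m n} → m ∈ xs → n ∈ xs → m < n → c m n ≤ D) →
  Σ (Fin k → ℕ) λ b → (∀ i → b i ∈ xs) × (∀ i j → i Fin.< j → b i < b j) ×
                      (∀ i j l → i Fin.< j → i Fin.< l → c (b i) (b j) ≡ c (b i) (b l))
greedy c D zero _ _ _ = (λ ()) , (λ ()) , (λ ()) , (λ ())
greedy c D (suc k) {a ∷ rest} (a<rest ∷ sorted) (s≤s len) c≤D
  with pigeonhole (c a) D (greedyLength D k) rest (λ x∈ → c≤D (here refl) (there x∈) (All.lookup a<rest x∈)) len
... | col , big
  with greedy c D k (AllPairs.filter⁺ _ sorted) big
         (λ m∈ n∈ → c≤D (there (proj₁ (∈-filter⁻ _ m∈))) (there (proj₁ (∈-filter⁻ _ n∈))))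
... | b′ , b′∈ , b′-inc , b′-hom = b , b∈ , b-inc , b-hom
  where
  in-class : ∀ i → b′ i ∈ rest × c a (b′ i) ≡ col
  in-class i = ∈-filter⁻ _ (b′∈ i)
  b : Fin (suc k) → ℕ
  b Fin.zero = a
  b (Fin.suc i) = b′ i
  b∈ : ∀ i → b i ∈ a ∷ rest
  b∈ Fin.zero = here refl
  b∈ (Fin.suc i) = there (proj₁ (in-class i))
  b-inc : ∀ i j → i Fin.< j → b i < b j
  b-inc Fin.zero (Fin.suc j) _ = All.lookup a<rest (proj₁ (in-class j))
  b-inc (Fin.suc i) (Fin.suc j) (s≤s i<j) = b′-inc i j i<j
  b-hom : ∀ i j l → i Fin.< j → i Fin.< l → c (b i) (b j) ≡ c (b i) (b l)
  b-hom Fin.zero (Fin.suc j) (Fin.suc l) _ _ = trans (proj₂ (in-class j)) (sym (proj₂ (in-class l)))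
  b-hom (Fin.suc i) (Fin.suc j) (Fin.suc l) (s≤s i<j) (s≤s i<l) = b′-hom i j l i<j i<l

IsLeast : (ℕ → Set) → ℕ → Set
IsLeast P m = P m × (∀ i → i < m → ¬ P i)

isLeast⇒≤ : ∀ {P m} → IsLeast P m → ∀ n → P n → m ≤ n
isLeast⇒≤ (_ , below) n Pn = ≮⇒≥ λ n<m → below n n<m Pn

firstBelow : ∀ {P} → U.Decidable P → ∀ n → (∃ λ m → m < n × IsLeast P m) ⊎ (∀ i → i < n → ¬ P i)
firstBelow P? zero = inj₂ λ _ ()
firstBelow P? (suc n) with firstBelow P? n
... | inj₁ (m , m<n , m-least) = inj₁ (m , m<n⇒m<1+n m<n , m-least)
... | inj₂ none with P? n
...   | yes Pn = inj₁ (n , ≤-refl , Pn , none)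
...   | no ¬Pn = inj₂ λ i i<1+n → [ none i , (λ { refl → ¬Pn }) ]′ (m<1+n⇒m<n∨m≡n i<1+n)

least : ∀ {P} → U.Decidable P → ∀ {n} → P n → ∃ λ m → m ≤ n × IsLeast P m
least P? {n} Pn with firstBelow P? (suc n)
... | inj₁ (m , m<1+n , m-least) = m , ≤-pred m<1+n , m-least
... | inj₂ none = ⊥-elim (none n ≤-refl Pn)

-- The j-th summand is 1 while f vanishes on 0, …, j and 0 afterwards, so the sum counts the zeros before
-- the first positive value of f.
boundedMin : (ℕ → ℕ) → ℕ → ℕ
boundedMin f B = sumBelow (λ j → prodBelow (λ i → 1 ∸ f i) (suc j)) B

module _ (f : ℕ → ℕ) where

  private
    prefix : ℕ → ℕ
    prefix j = prodBelow (λ i → 1 ∸ f i) (suc j)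

    prefix-zeros : ∀ j → (∀ i → i ≤ j → f i ≡ 0) → prefix j ≡ 1
    prefix-zeros zero zeros rewrite zeros 0 z≤n = refl
    prefix-zeros (suc j) zeros
      rewrite prefix-zeros j (λ i i≤j → zeros i (m≤n⇒m≤1+n i≤j)) | zeros (suc j) ≤-refl = refl

    prefix-positive : ∀ {m} j → m ≤ j → 0 < f m → prefix j ≡ 0
    prefix-positive {m} j m≤j pos with m<1+n⇒m<n∨m≡n (s≤s m≤j)
    prefix-positive {m} (suc j) _ pos | inj₁ m<1+j rewrite prefix-positive j (≤-pred m<1+j) pos = refl
    prefix-positive {m} m _ pos | inj₂ refl with f m | pos
    ... | suc v | _ rewrite 0∸n≡0 v = *-zeroʳ (prodBelow (λ i → 1 ∸ f i) m)

  boundedMin-least : ∀ {m B} → IsLeast (λ n → 0 < f n) m → m < B → boundedMin f B ≡ m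
  boundedMin-least {m} (pos , below) = above
    where
    zeros : ∀ i → i < m → f i ≡ 0
    zeros i i<m = n≤0⇒n≡0 (≮⇒≥ (below i i<m))
    upTo-m : ∀ B → B ≤ m → boundedMin f B ≡ B
    upTo-m zero _ = refl
    upTo-m (suc B) B<m
      rewrite upTo-m B (<⇒≤ B<m) | prefix-zeros B (λ i i≤B → zeros i (≤-<-trans i≤B B<m)) = +-comm B 1
    above : ∀ {B} → m < B → boundedMin f B ≡ m
    above {suc B} m<1+B with m<1+n⇒m<n∨m≡n m<1+B
    ... | inj₁ m<B rewrite above m<B | prefix-positive B (<⇒≤ m<B) pos = +-identityʳ m
    ... | inj₂ refl rewrite upTo-m m ≤-refl | prefix-positive m ≤-refl pos = +-identityʳ m

  boundedMin-positive : ∀ B → 0 < f B → IsLeast (λ n → 0 < f n) (boundedMin f (suc B)) × boundedMin f (suc B) ≤ B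
  boundedMin-positive B pos with least (λ n → 0 <? f n) pos
  ... | m , m≤B , m-least rewrite boundedMin-least m-least (s≤s m≤B) = m-least , m≤B

boundedMin-primRec : ∀ {f B} → IsPrimRec₂ f → IsPrimRec B →
  IsPrimRec (λ k → boundedMin (λ n → f n k) (suc (B k)))
boundedMin-primRec F B′
  with compile id-primRec (∑< (ap₁ suc-primRec (ap₁ B′ (var (# 0))))
                              (∏< (ap₁ suc-primRec (var (# 0))) (lit 1 ⊖ ap₂ F (var (# 0)) (var (# 2)))))
... | p , p-ok = p , λ k → p-ok (k ∷ [])

rootSearch-pow-≤ : ∀ n b K → rootSearch n b K ≡ 0 ⊎ rootSearch n b K ^ b ≤ n
rootSearch-pow-≤ n b zero = inj₁ refl
rootSearch-pow-≤ n b (suc K) with (suc K ^ b) ≤ᵇ n in eq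
... | true = inj₂ (≤ᵇ⇒≤ (suc K ^ b) n (subst T (sym eq) _))
... | false = rootSearch-pow-≤ n b K

-- A positive stand-in for ⌊n^(1/b)⌋, which may be 0.
floorRoot-cover : ∀ {n} b → 1 ≤ n → ∃ λ s → 1 ≤ s × s ^ b ≤ n × 2 + floorRoot n b ≤ 3 * s
floorRoot-cover {n} b 1≤n with floorRoot n b | rootSearch-pow-≤ n b n
... | zero | _ = 1 , ≤-refl , subst (_≤ n) (sym (^-zeroˡ b)) 1≤n , s≤s (s≤s z≤n)
... | suc r | inj₂ r^b≤n = suc r , s≤s z≤n , r^b≤n ,
  subst (_≤ 3 * suc r) (+-comm (suc r) 2) (+-monoʳ-≤ (suc r) (*-monoʳ-≤ 2 (s≤s z≤n)))

greedyLength-≤ : ∀ D k → greedyLength D k ≤ (2 + D) ^ k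
greedyLength-≤ D zero = z≤n
greedyLength-≤ D (suc k) = begin
  suc (suc D * greedyLength D k) ≤⟨ s≤s (*-monoʳ-≤ (suc D) (greedyLength-≤ D k)) ⟩
  suc (suc D * P)               ≤⟨ +-monoˡ-≤ (suc D * P) (m^n>0 (2 + D) k) ⟩
  P + suc D * P                 ∎
  where
  open ≤-Reasoning
  P = (2 + D) ^ k

^-distribʳ-* : ∀ m n k → (m * n) ^ k ≡ m ^ k * n ^ k
^-distribʳ-* m n zero = refl
^-distribʳ-* m n (suc k) = trans (cong (m * n *_) (^-distribʳ-* m n k)) ([m*n]*[o*p]≡[m*o]*[n*p] m n (m ^ k) (n ^ k))

m*m≤n*n⇒m≤n : ∀ {m n} → m * m ≤ n * n → m ≤ n
m*m≤n*n⇒m≤n {m} {n} m²≤n² with m ≤? n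
... | yes m≤n = m≤n
... | no m≰n = ⊥-elim (<⇒≱ (*-mono-< (≰⇒> m≰n) (≰⇒> m≰n)) m²≤n²)

greedyLength-floorRoot-≤ : ∀ {A b} k → 1 ≤ A → 2 * k ≤ b → 3 ^ k ≤ A →
  greedyLength (floorRoot (A * A) b) k ≤ A * A
greedyLength-floorRoot-≤ {A} {b} k 1≤A 2k≤b 3^k≤A with floorRoot-cover b (*-mono-≤ 1≤A 1≤A)
... | s , 1≤s , s^b≤A² , root≤3s = begin
  greedyLength (floorRoot (A * A) b) k ≤⟨ greedyLength-≤ _ k ⟩
  (2 + floorRoot (A * A) b) ^ k        ≤⟨ ^-monoˡ-≤ k root≤3s ⟩
  (3 * s) ^ k                          ≡⟨ ^-distribʳ-* 3 s k ⟩
  3 ^ k * s ^ k                        ≤⟨ *-mono-≤ 3^k≤A s^k≤A ⟩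
  A * A                                ∎
  where
  open ≤-Reasoning
  instance _ = >-nonZero 1≤s
  s^k≤A : s ^ k ≤ A
  s^k≤A = m*m≤n*n⇒m≤n (begin
    s ^ k * s ^ k ≡⟨ ^-distribˡ-+-* s k k ⟨
    s ^ (k + k)   ≤⟨ ^-monoʳ-≤ s (subst (_≤ b) (cong (k +_) (+-identityʳ k)) 2k≤b) ⟩
    s ^ b         ≤⟨ s^b≤A² ⟩
    A * A         ∎)

minArrow-at-square : ∀ {g β} → WeaklyIncreasing g → WeaklyIncreasing β →
  (∀ n → 1 ≤ β n → g n ≤ floorRoot n (β n)) →
  ∀ k {m A} → 2 * k ≤ β m → m < A → 3 ^ k ≤ A → MinArrow (A * A) k g
minArrow-at-square g↑ β↑ root zero _ _ _ c _ = (λ ()) , (λ ()) , (λ ()) , (λ ())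
minArrow-at-square {g} {β} g↑ β↑ root k@(suc _) {m} {A} 2k≤βm m<A 3^k≤A c c-reg
  with greedy c r k (AllPairs.applyUpTo⁺₁ id N λ i<j _ → i<j) size colours≤r
  where
  N : ℕ
  N = A * A
  1≤A : 1 ≤ A
  1≤A = ≤-trans (s≤s z≤n) m<A
  2k≤βN : 2 * k ≤ β N
  2k≤βN = ≤-trans 2k≤βm (β↑ m N (≤-trans (<⇒≤ m<A) (m≤m*n A A {{>-nonZero 1≤A}})))
  r : ℕ
  r = floorRoot N (β N)
  size : greedyLength r k ≤ length (upTo N)
  size = subst (greedyLength r k ≤_) (sym (length-upTo N)) (greedyLength-floorRoot-≤ k 1≤A 2k≤βN 3^k≤A)
  colours≤r : ∀ {m n} → m ∈ upTo N → n ∈ upTo N → m < n → c m n ≤ r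
  colours≤r m∈ n∈ m<n = ≤-trans (c-reg _ _ m<n (∈-upTo⁻ n∈))
    (≤-trans (g↑ _ _ (<⇒≤ (∈-upTo⁻ m∈))) (root N (≤-trans (s≤s z≤n) 2k≤βN)))
... | b , b∈ , b-inc , b-hom = b , b-inc , (λ i → ∈-upTo⁻ (b∈ i)) , b-hom

inverse-bound-reaches : ∀ {β h : ℕ → ℕ} → WeaklyIncreasing β → Unbounded β →
  (∀ t m → IsInverseAt β t m → m ≤ h t) → ∀ t → t ≤ β (h t)
inverse-bound-reaches {β} β↑ β-unbounded h-inverse t with β-unbounded t
... | _ , t≤βn with least (λ n → t ≤? β n) t≤βn
... | m , _ , m-least = ≤-trans (proj₁ m-least) (β↑ m _ (h-inverse t m (proj₁ m-least , isLeast⇒≤ m-least)))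

nuBoundRoot : (ℕ → ℕ) → ℕ → ℕ
nuBoundRoot h k = 3 ^ k + h (2 * k) + 1

nuBound : (ℕ → ℕ) → ℕ → ℕ
nuBound h k = nuBoundRoot h k * nuBoundRoot h k

nuBound-primRec : ∀ {h} → IsPrimRec h → IsPrimRec (nuBound h)
nuBound-primRec H with compile id-primRec (root ⊗ root)
  where
  root : Exp 1
  root = ap₂ ^-primRec (lit 3) (var (# 0)) ⊕ ap₁ H (lit 2 ⊗ var (# 0)) ⊕ lit 1
... | p , p-ok = p , λ k → p-ok (k ∷ [])

minArrow-nuBound : ∀ {g β h : ℕ → ℕ} → WeaklyIncreasing g → WeaklyIncreasing β →
  (∀ n → 1 ≤ β n → g n ≤ floorRoot n (β n)) → (∀ t → t ≤ β (h t)) → ∀ k → MinArrow (nuBound h k) k g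
minArrow-nuBound {h = h} g↑ β↑ root reaches k = minArrow-at-square g↑ β↑ root k (reaches (2 * k))
  (≤-trans (s≤s (m≤n+m (h (2 * k)) (3 ^ k))) (≤-reflexive (+-comm 1 _)))
  (≤-trans (m≤m+n (3 ^ k) (h (2 * k))) (m≤m+n _ 1))

leastArrowBelow : (ℕ → ℕ) → ℕ → ℕ → ℕ
leastArrowBelow g k B = boundedMin (λ N → minArrowχ g N k) B

leastArrowBelow-isNu : ∀ {g k B} → WeaklyIncreasing g → MinArrow B k g →
  IsNu g k (leastArrowBelow g k (suc B)) × leastArrowBelow g k (suc B) ≤ B
leastArrowBelow-isNu {g} {k} {B} g↑ arrow =
  (minArrowχ-sound g↑ (proj₁ least-N) , λ M arrow-M → isLeast⇒≤ least-N M (minArrowχ-complete arrow-M)) , proj₂ search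
  where
  search : IsLeast (λ N → 0 < minArrowχ g N k) (leastArrowBelow g k (suc B)) × leastArrowBelow g k (suc B) ≤ B
  search = boundedMin-positive (λ N → minArrowχ g N k) B (minArrowχ-complete arrow)
  least-N : IsLeast (λ N → 0 < minArrowχ g N k) (leastArrowBelow g k (suc B))
  least-N = proj₁ search

mainTheorem2 : (g β : ℕ → ℕ) →
    WeaklyIncreasing g → WeaklyIncreasing β → Unbounded β →
    (∀ n → 1 ≤ β n → g n ≤ floorRoot n (β n)) →
    (Σ (ℕ → ℕ) λ h → IsPrimRec h × (∀ t m → IsInverseAt β t m → m ≤ h t)) →
    Σ (ℕ → ℕ) λ ν → (∀ k → IsNu g k (ν k)) × PrimRecBounded ν × (IsPrimRec g → IsPrimRec ν)
mainTheorem2 g β g↑ β↑ β-unbounded root (h , h-primRec , h-inverse) =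
  ν , proj₁ ∘ ν-spec , (nuBound h , nuBound-primRec h-primRec , proj₂ ∘ ν-spec) , ν-primRec
  where
  ν : ℕ → ℕ
  ν k = leastArrowBelow g k (suc (nuBound h k))
  ν-spec : ∀ k → IsNu g k (ν k) × ν k ≤ nuBound h k
  ν-spec k = leastArrowBelow-isNu g↑ (minArrow-nuBound g↑ β↑ root (inverse-bound-reaches β↑ β-unbounded h-inverse) k)
  ν-primRec : IsPrimRec g → IsPrimRec ν
  ν-primRec g-primRec = boundedMin-primRec (minArrowχ-primRec g-primRec) (nuBound-primRec h-primRec)
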